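{- Let $k\geq 2$ be an integer, let $G$ be a graph, and let $(H,p)$ be one of the pairs $(C_k,k)$, $(P_k,2k-2)$, $(P_k^*,2k-1)$, $(P_k^{**},2k)$. Let $x,y_1,\ldots,y_{p-1},z$ be a path in $G$ such that each $y_i$ has degree $2$ in $G$. If $G$ has an $H$-role colouring $r$, then $r(x)=r(z)$.
   Context: Graphs are finite, undirected, without multiple edges, and may have loops (a loop at $v$ puts $v$ in its own neighbourhood $N(v)$ and counts towards its degree). $P_k$ has vertex set $\{1,\ldots,k\}$ and edges $\{i,i+1\}$ for $1\le i<k$; $C_k$ is $P_k$ plus the edge $\{k,1\}$; $P_k^*$ is $P_k$ plus a loop at $k$; $P_k^{**}$ is $P_k$ plus loops at $1$ and at $k$. A role colouring of $G$ is a map $r:V(G)\to\mathbb{N}^+$ such that $r(u)=r(v)$ implies $\{r(u'):u'\in N(u)\}=\{r(v'):v'\in N(v)\}$. Its role graph is the graph on the set of used colours with an edge $\{x,y\}$ (possibly a loop) whenever some vertex of colour $x$ has a neighbour of colour $y$. For a graph $H$, an $H$-role colouring of $G$ is a role colouring $r:V(G)\to V(H)$ whose role graph is exactly $H$ (equivalently, a locally surjective homomorphism from $G$ onto $H$). -}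

module Defs where

open import Data.Nat using (ℕ; zero; suc; _∸_; _*_; _+_; _≡ᵇ_; _<_)
open import Data.Bool using (Bool; true; false; _∨_; _∧_; if_then_else_)
open import Data.Bool.Properties using (∨-comm)
open import Data.Fin using (Fin; toℕ; inject₁; fromℕ) renaming (zero to fzero; suc to fsuc)
open import Data.List using (List; map; allFin)
open import Data.Nat.ListAction using (sum)
open import Data.Product using (Σ; _×_; _,_; ∃)
open import Function.Bundles using (_⇔_)
open import Relation.Binary.PropositionalEquality using (_≡_)

-- Finite undirected graphs, loops allowed, no multiple edges.
-- Vertex set Fin n; E u v = true iff {u,v} is an edge (u ≡ v: a loop).
record Graph : Set where
  field
    n   : ℕ
    E   : Fin n → Fin n → Bool
    sym : ∀ u v → E u v ≡ E v u

open Graph public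

V : Graph → Set
V G = Fin (n G)

Adj : (G : Graph) → V G → V G → Set
Adj G u v = E G u v ≡ true

-- degree = |N(v)| (a loop puts v in N(v) and so counts towards the degree)
degree : (G : Graph) → V G → ℕ
degree G u = sum (map (λ v → if E G u v then 1 else 0) (allFin (n G)))

IsRoleColouring : {C : Set} (G : Graph) → (V G → C) → Set
IsRoleColouring {C} G r =
  ∀ u v → r u ≡ r v →
    ∀ (c : C) → (Σ (V G) λ u' → Adj G u u' × r u' ≡ c)
              ⇔ (Σ (V G) λ v' → Adj G v v' × r v' ≡ c)

IsHRoleColouring : (G H : Graph) → (V G → V H) → Set
IsHRoleColouring G H r =
  IsRoleColouring G r
  × (∀ (h : V H) → Σ (V G) λ u → r u ≡ h)
  × (∀ (a b : V H) → Adj H a b ⇔ (Σ (V G) λ u → Σ (V G) λ v → r u ≡ a × r v ≡ b × Adj G u v))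

-- The target graphs on vertex set Fin k; vertex i ∈ {1..k} is Fin index i-1.

symClose : {m : ℕ} → (Fin m → Fin m → Bool) → Fin m → Fin m → Bool
symClose f i j = f i j ∨ f j i

symClose-sym : {m : ℕ} (f : Fin m → Fin m → Bool) → ∀ i j → symClose f i j ≡ symClose f j i
symClose-sym f i j = ∨-comm (f i j) (f j i)

mkGraph : (m : ℕ) → (Fin m → Fin m → Bool) → Graph
mkGraph m f = record { n = m ; E = symClose f ; sym = symClose-sym f }

pathE : (k : ℕ) → Fin k → Fin k → Bool
pathE k i j = toℕ j ≡ᵇ suc (toℕ i)

closeE : (k : ℕ) → Fin k → Fin k → Bool
closeE k i j = (toℕ i ≡ᵇ (k ∸ 1)) ∧ (toℕ j ≡ᵇ 0)

loopLast : (k : ℕ) → Fin k → Fin k → Bool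
loopLast k i j = (toℕ i ≡ᵇ (k ∸ 1)) ∧ (toℕ j ≡ᵇ (k ∸ 1))

loopFirst : (k : ℕ) → Fin k → Fin k → Bool
loopFirst k i j = (toℕ i ≡ᵇ 0) ∧ (toℕ j ≡ᵇ 0)

Pk : ℕ → Graph
Pk k = mkGraph k (pathE k)

Ck : ℕ → Graph
Ck k = mkGraph k (λ i j → pathE k i j ∨ closeE k i j)

Pk* : ℕ → Graph
Pk* k = mkGraph k (λ i j → pathE k i j ∨ loopLast k i j)

Pk** : ℕ → Graph
Pk** k = mkGraph k (λ i j → pathE k i j ∨ loopLast k i j ∨ loopFirst k i j)

data Kind : Set where
  cyc path path* path** : Kind

targetH : ℕ → Kind → Graph
targetH k cyc    = Ck k
targetH k path   = Pk k
targetH k path*  = Pk* k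
targetH k path** = Pk** k

targetP : ℕ → Kind → ℕ
targetP k cyc    = k
targetP k path   = 2 * k ∸ 2
targetP k path*  = 2 * k ∸ 1
targetP k path** = 2 * k

-- A path w 0, w 1, …, w p in G (distinct vertices, consecutive adjacent).
-- x = w 0, y_i = w i (0 < i < p), z = w p.
IsPath : (G : Graph) (p : ℕ) → (Fin (suc p) → V G) → Set
IsPath G p w =
  (∀ i j → w i ≡ w j → i ≡ j)
  × (∀ (i : Fin p) → Adj G (w (inject₁ i)) (w (fsuc i)))

module Submission where

-- Colour the path x = w 0, w 1, …, w p = z by the
-- numbers c j = r (w j) ∈ {0, …, k-1}.  A role colouring onto H is locally
-- surjective, and every interior vertex w (1+j) has exactly the two
-- neighbours w j and w (2+j); hence every H-neighbour of c (1+j) is c j or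
-- c (2+j).  So the colours form a "forced walk" in H, which is determined
-- by its first arc (c 0 , c 1).  In each of the four graphs H (vertices
-- 0 … K, K = k-1) the forced walk through any arc is closed of length
-- exactly p: go up 0 → ⋯ → K, turn at K, come down, turn at 0 (C_k is
-- traversed once in either direction).  Hence c p = c 0.

open import Defs hiding (sym)
open import Data.Bool using (Bool; T; _∨_; _∧_; if_then_else_)
open import Data.Bool.Properties using (T-≡; T-∨; T-∧)
open import Data.Empty using (⊥-elim)
open import Data.Fin using (Fin; toℕ; fromℕ; fromℕ<; inject₁; punchOut) renaming (zero to fzero; suc to fsuc)
open import Data.Fin.Properties using (_≟_; toℕ-injective; toℕ≤pred[n]; toℕ-fromℕ; toℕ-fromℕ<; toℕ-inject₁; punchOut-injective)
open import Data.List using (tabulate)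
open import Data.List.Properties using (map-tabulate)
open import Data.Nat using (ℕ; zero; suc; _+_; _≤_; _<_; _≡ᵇ_; z≤n; s≤s)
open import Data.Nat.DivMod using (_mod_; m<n⇒m%n≡m)
open import Data.Nat.ListAction using () renaming (sum to listSum)
open import Data.Nat.Properties
  using (module ≤-Reasoning; ≡ᵇ⇒≡; ≡⇒≡ᵇ; ≤-refl; ≤-trans; n≤1+n; 1+n≰n; <-irrefl; <⇒≢; m≤m+n; m≤n+m; m<n+m; +-monoʳ-≤; +-0-commutativeMonoid)
open import Data.Nat.Tactic.RingSolver using (solve-∀)
open import Algebra.Properties.CommutativeMonoid.Sum +-0-commutativeMonoid using (sum-remove) renaming (sum to ∑)
open import Data.Product using (Σ; _×_; _,_; proj₁; proj₂)
open import Data.Sum using (_⊎_; inj₁; inj₂; [_,_]) renaming (map to ⊎-map)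
open import Data.Vec.Functional using (Vector; removeAt)
open import Data.Vec.Functional.Properties using (removeAt-punchOut)
open import Function using (_∘′_)
open import Function.Bundles using (Equivalence)
open import Relation.Nullary using (yes; no)
open import Relation.Binary.PropositionalEquality using (_≡_; _≢_; refl; sym; trans; cong; cong₂; subst; subst₂; module ≡-Reasoning)

open Equivalence using (to; from)

-- Forced walks in a graph given by a neighbour relation Nb on A

module _ {A : Set} (Nb : A → A → Set) where

  record Forced (a b c : A) : Set where
    constructor forced
    field
      prev     : Nb b a
      next     : Nb b c
      no-other : ∀ d → Nb b d → d ≡ a ⊎ d ≡ c

  -- Run n a b y z: the forced walk entering b from a reaches the arc y → z
  -- after n steps.
  data Run : ℕ → A → A → A → A → Set where
    []  : ∀ {a b} → Run 0 a b a b
    _∷_ : ∀ {n a b c y z} → Forced a b c → Run n b c y z → Run (suc n) a b y z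

  infixr 5 _∷_

  Closed : ℕ → A → A → Set
  Closed n a b = Run n a b a b

module _ {A : Set} {Nb : A → A → Set} where

  open Forced

  infixl 5 _∷ʳ_
  infixr 5 _++_

  forced-unique : ∀ {a b c c′} → Forced Nb a b c → Forced Nb a b c′ → c ≡ c′
  forced-unique f f′ with no-other f _ (next f′)
  ... | inj₂ c′≡c = sym c′≡c
  ... | inj₁ c′≡a with no-other f′ _ (next f)
  ...   | inj₁ c≡a  = trans c≡a (sym c′≡a)
  ...   | inj₂ c≡c′ = c≡c′

  forced-flip : ∀ {a b c} → Forced Nb a b c → Forced Nb c b a
  forced-flip (forced p q only) = forced q p (λ d nb → [ inj₂ , inj₁ ] (only d nb))

  _∷ʳ_ : ∀ {n a b x y z} → Run Nb n a b x y → Forced Nb x y z → Run Nb (suc n) a b y z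
  [] ∷ʳ t      = t ∷ []
  (s ∷ ρ) ∷ʳ t = s ∷ (ρ ∷ʳ t)

  _++_ : ∀ {m n a b x y u v} → Run Nb m a b x y → Run Nb n x y u v → Run Nb (m + n) a b u v
  [] ++ σ      = σ
  (s ∷ ρ) ++ σ = s ∷ (ρ ++ σ)

  reverse : ∀ {n a b y z} → Run Nb n a b y z → Run Nb n z y b a
  reverse []      = []
  reverse (t ∷ ρ) = reverse ρ ∷ʳ forced-flip t

  unsnoc : ∀ {n a b y z} → Run Nb (suc n) a b y z → Σ A λ x → Run Nb n a b x y
  unsnoc (t ∷ [])      = _ , []
  unsnoc (t ∷ (s ∷ ρ)) with unsnoc (s ∷ ρ)
  ... | x , σ = x , t ∷ σ

  rotate : ∀ {n a b c} → Closed Nb n a b → Forced Nb a b c → Closed Nb n b c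
  rotate [] t = []
  rotate (s ∷ ρ) t = subst (λ c → Closed Nb _ _ c) (forced-unique s t) (ρ ∷ʳ s)

  rotate-along : ∀ {n m a b y z} → Closed Nb n a b → Run Nb m a b y z → Closed Nb n y z
  rotate-along κ []      = κ
  rotate-along κ (t ∷ ρ) = rotate-along (rotate κ t) ρ

  follow : ∀ {P n y z} (c : ℕ → A)
         → (∀ j → 2 + j ≤ P → Forced Nb (c j) (c (1 + j)) (c (2 + j)))
         → Run Nb n (c 0) (c 1) y z → n < P → y ≡ c n × z ≡ c (suc n)
  follow c forced-at [] _ = refl , refl
  follow {suc P} c forced-at (t ∷ ρ) (s≤s n<P) =
    follow (λ j → c (suc j)) (λ j h → forced-at (suc j) (s≤s h))
           (subst (λ x → Run Nb _ (c 1) x _ _) (forced-unique t (forced-at 0 (s≤s (≤-trans (s≤s z≤n) n<P)))) ρ)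
           n<P

  returns : ∀ {P} (c : ℕ → A) → Closed Nb P (c 0) (c 1)
          → (∀ j → 2 + j ≤ P → Forced Nb (c j) (c (1 + j)) (c (2 + j)))
          → c P ≡ c 0
  returns {zero}  c κ forced-at = refl
  returns {suc P} c κ forced-at with unsnoc κ
  ... | x , ρ with follow c forced-at ρ ≤-refl
  ...   | _ , c0≡cP = sym c0≡cP

  forced-map : ∀ {B : Set} {Nb′ : B → B → Set} (f : A → B)
             → (∀ {a b} → Nb a b → Nb′ (f a) (f b))
             → (∀ {a d} → Nb′ (f a) d → Σ A λ b → f b ≡ d × Nb a b)
             → ∀ {a b c} → Forced Nb a b c → Forced Nb′ (f a) (f b) (f c)
  forced-map {Nb′ = Nb′} f preserve lift {a} {b} {c} (forced p q only) =
    forced (preserve p) (preserve q) only′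
    where
    only′ : ∀ d → Nb′ (f b) d → d ≡ f a ⊎ d ≡ f c
    only′ d nb with lift nb
    ... | b′ , fb′≡d , nb′ = ⊎-map (λ e → trans (sym fb′≡d) (cong f e))
                                   (λ e → trans (sym fb′≡d) (cong f e)) (only b′ nb′)

-- The graphs H on ℕ.  For K : ℕ the vertices are 0 … K, and Arrow kd K
-- lists the directed generators of targetH (suc K) kd; Step is their
-- symmetric closure, i.e. the adjacency of H.

data Arrow : Kind → ℕ → ℕ → ℕ → Set where
  succ        : ∀ {kd K a} → a < K → Arrow kd K a (suc a)
  close       : ∀ {K} → Arrow cyc K K 0
  loop-top*   : ∀ {K} → Arrow path* K K K
  loop-top**  : ∀ {K} → Arrow path** K K K
  loop-bottom : ∀ {K} → Arrow path** K 0 0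

Step : Kind → ℕ → ℕ → ℕ → Set
Step kd K a b = Arrow kd K a b ⊎ Arrow kd K b a

arrow-bound : ∀ {kd K a b} → Arrow kd K a b → a ≤ K × b ≤ K
arrow-bound (succ a<K)  = ≤-trans (n≤1+n _) a<K , a<K
arrow-bound close       = ≤-refl , z≤n
arrow-bound loop-top*   = ≤-refl , ≤-refl
arrow-bound loop-top**  = ≤-refl , ≤-refl
arrow-bound loop-bottom = z≤n , z≤n

step-bound : ∀ {kd K a b} → Step kd K a b → b ≤ K
step-bound (inj₁ arr) = proj₂ (arrow-bound arr)
step-bound (inj₂ arr) = proj₁ (arrow-bound arr)

-- The directed generators as a Boolean function on ℕ; for every kind,
-- targetH (suc K) kd is by definition the graph model kd K below.
arrowᵇ : Kind → ℕ → ℕ → ℕ → Bool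
arrowᵇ cyc    K x y = (y ≡ᵇ suc x) ∨ ((x ≡ᵇ K) ∧ (y ≡ᵇ 0))
arrowᵇ path   K x y = y ≡ᵇ suc x
arrowᵇ path*  K x y = (y ≡ᵇ suc x) ∨ ((x ≡ᵇ K) ∧ (y ≡ᵇ K))
arrowᵇ path** K x y = (y ≡ᵇ suc x) ∨ ((x ≡ᵇ K) ∧ (y ≡ᵇ K)) ∨ ((x ≡ᵇ 0) ∧ (y ≡ᵇ 0))

model : Kind → ℕ → Graph
model kd K = mkGraph (suc K) (λ i j → arrowᵇ kd K (toℕ i) (toℕ j))

≡ᵇ-refl : ∀ n → T (n ≡ᵇ n)
≡ᵇ-refl n = ≡⇒≡ᵇ n n refl

both-true : ∀ x y → T ((x ≡ᵇ x) ∧ (y ≡ᵇ y))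
both-true x y = from T-∧ (≡ᵇ-refl x , ≡ᵇ-refl y)

both-equal : ∀ x p y q → T ((x ≡ᵇ p) ∧ (y ≡ᵇ q)) → x ≡ p × y ≡ q
both-equal x p y q t with to (T-∧ {x ≡ᵇ p} {y ≡ᵇ q}) t
... | tx , ty = ≡ᵇ⇒≡ x p tx , ≡ᵇ⇒≡ y q ty

succ-decode : ∀ {kd K x y} → y ≤ K → T (y ≡ᵇ suc x) → Arrow kd K x y
succ-decode {x = x} {y} y≤K t with ≡ᵇ⇒≡ y (suc x) t
... | refl = succ y≤K

arrow-decode : ∀ kd {K x y} → y ≤ K → T (arrowᵇ kd K x y) → Arrow kd K x y
arrow-decode cyc {K} {x} {y} y≤K t with to T-∨ t
... | inj₁ t′ = succ-decode y≤K t′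
... | inj₂ t′ with both-equal x K y 0 t′
...   | refl , refl = close
arrow-decode path y≤K t = succ-decode y≤K t
arrow-decode path* {K} {x} {y} y≤K t with to T-∨ t
... | inj₁ t′ = succ-decode y≤K t′
... | inj₂ t′ with both-equal x K y K t′
...   | refl , refl = loop-top*
arrow-decode path** {K} {x} {y} y≤K t with to T-∨ t
... | inj₁ t′ = succ-decode y≤K t′
... | inj₂ t′ with to T-∨ t′
...   | inj₁ t″ with both-equal x K y K t″
...     | refl , refl = loop-top**
arrow-decode path** {K} {x} {y} y≤K t | inj₂ t′ | inj₂ t″ with both-equal x 0 y 0 t″
...     | refl , refl = loop-bottom

∨-introˡ : ∀ x y → T x → T (x ∨ y)
∨-introˡ x y t = from (T-∨ {x} {y}) (inj₁ t)

∨-introʳ : ∀ x y → T y → T (x ∨ y)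
∨-introʳ x y t = from (T-∨ {x} {y}) (inj₂ t)

arrow-encode : ∀ {kd K x y} → Arrow kd K x y → T (arrowᵇ kd K x y)
arrow-encode {cyc}    (succ {a = x} _) = ∨-introˡ _ _ (≡ᵇ-refl x)
arrow-encode {path}   (succ {a = x} _) = ≡ᵇ-refl x
arrow-encode {path*}  (succ {a = x} _) = ∨-introˡ _ _ (≡ᵇ-refl x)
arrow-encode {path**} (succ {a = x} _) = ∨-introˡ _ _ (≡ᵇ-refl x)
arrow-encode (close {K}) = ∨-introʳ (0 ≡ᵇ suc K) _ (both-true K 0)
arrow-encode (loop-top* {K}) = ∨-introʳ (K ≡ᵇ suc K) _ (both-true K K)
arrow-encode (loop-top** {K}) =
  ∨-introʳ (K ≡ᵇ suc K) _ (∨-introˡ ((K ≡ᵇ K) ∧ (K ≡ᵇ K)) ((K ≡ᵇ 0) ∧ (K ≡ᵇ 0)) (both-true K K))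
arrow-encode (loop-bottom {K}) =
  ∨-introʳ (0 ≡ᵇ 1) _ (∨-introʳ ((0 ≡ᵇ K) ∧ (0 ≡ᵇ K)) ((0 ≡ᵇ 0) ∧ (0 ≡ᵇ 0)) (both-true 0 0))

model-decode : ∀ {kd K} (a b : Fin (suc K)) → Adj (model kd K) a b → Step kd K (toℕ a) (toℕ b)
model-decode {kd} a b adj =
  ⊎-map (arrow-decode kd (toℕ≤pred[n] b)) (arrow-decode kd (toℕ≤pred[n] a)) (to T-∨ (from T-≡ adj))

model-encode : ∀ {kd K} (a : Fin (suc K)) {d} → Step kd K (toℕ a) d
             → Σ (Fin (suc K)) λ b → toℕ b ≡ d × Adj (model kd K) a b
model-encode {kd} {K} a {d} s = b , b≡d , to T-≡ (from T-∨ (⊎-map arrow-encode arrow-encode s′))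
  where
  b = fromℕ< (s≤s (step-bound s))
  b≡d = toℕ-fromℕ< (s≤s (step-bound s))
  s′ : Step kd K (toℕ a) (toℕ b)
  s′ = subst (Step kd K (toℕ a)) (sym b≡d) s

forced-ascend : ∀ {kd K j} → suc (suc j) ≤ K → Forced (Step kd K) j (suc j) (suc (suc j))
forced-ascend {j = j} h = forced (inj₂ (succ (≤-trans (n≤1+n _) h))) (inj₁ (succ h)) only
  where
  only : ∀ d → Step _ _ (suc j) d → d ≡ j ⊎ d ≡ suc (suc j)
  only _ (inj₁ (succ _))   = inj₂ refl
  only _ (inj₁ close)      = ⊥-elim (1+n≰n h)
  only _ (inj₁ loop-top*)  = ⊥-elim (1+n≰n h)
  only _ (inj₁ loop-top**) = ⊥-elim (1+n≰n h)
  only _ (inj₂ (succ _))   = inj₁ refl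
  only _ (inj₂ loop-top*)  = ⊥-elim (1+n≰n h)
  only _ (inj₂ loop-top**) = ⊥-elim (1+n≰n h)

top-cyc : ∀ {m} → Forced (Step cyc (suc m)) m (suc m) 0
top-cyc {m} = forced (inj₂ (succ ≤-refl)) (inj₁ close) only
  where
  only : ∀ d → Step cyc (suc m) (suc m) d → d ≡ m ⊎ d ≡ 0
  only _ (inj₁ (succ h)) = ⊥-elim (1+n≰n h)
  only _ (inj₁ close)    = inj₂ refl
  only _ (inj₂ (succ _)) = inj₁ refl

bottom-cyc : ∀ {m} → Forced (Step cyc (suc m)) (suc m) 0 1
bottom-cyc {m} = forced (inj₂ close) (inj₁ (succ (s≤s z≤n))) only
  where
  only : ∀ d → Step cyc (suc m) 0 d → d ≡ suc m ⊎ d ≡ 1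
  only _ (inj₁ (succ _)) = inj₂ refl
  only _ (inj₂ close)    = inj₁ refl

top-path : ∀ {m} → Forced (Step path (suc m)) m (suc m) m
top-path {m} = forced (inj₂ (succ ≤-refl)) (inj₂ (succ ≤-refl)) only
  where
  only : ∀ d → Step path (suc m) (suc m) d → d ≡ m ⊎ d ≡ m
  only _ (inj₁ (succ h)) = ⊥-elim (1+n≰n h)
  only _ (inj₂ (succ _)) = inj₁ refl

bottom-path : ∀ {m} → Forced (Step path (suc m)) 1 0 1
bottom-path {m} = forced (inj₁ (succ (s≤s z≤n))) (inj₁ (succ (s≤s z≤n))) only
  where
  only : ∀ d → Step path (suc m) 0 d → d ≡ 1 ⊎ d ≡ 1
  only _ (inj₁ (succ _)) = inj₁ refl

top-path* : ∀ {m} → Forced (Step path* (suc m)) m (suc m) (suc m)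
top-path* {m} = forced (inj₂ (succ ≤-refl)) (inj₁ loop-top*) only
  where
  only : ∀ d → Step path* (suc m) (suc m) d → d ≡ m ⊎ d ≡ suc m
  only _ (inj₁ (succ h))  = ⊥-elim (1+n≰n h)
  only _ (inj₁ loop-top*) = inj₂ refl
  only _ (inj₂ (succ _))  = inj₁ refl
  only _ (inj₂ loop-top*) = inj₂ refl

bottom-path* : ∀ {m} → Forced (Step path* (suc m)) 1 0 1
bottom-path* {m} = forced (inj₁ (succ (s≤s z≤n))) (inj₁ (succ (s≤s z≤n))) only
  where
  only : ∀ d → Step path* (suc m) 0 d → d ≡ 1 ⊎ d ≡ 1
  only _ (inj₁ (succ _)) = inj₁ refl

top-path** : ∀ {m} → Forced (Step path** (suc m)) m (suc m) (suc m)
top-path** {m} = forced (inj₂ (succ ≤-refl)) (inj₁ loop-top**) only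
  where
  only : ∀ d → Step path** (suc m) (suc m) d → d ≡ m ⊎ d ≡ suc m
  only _ (inj₁ (succ h))   = ⊥-elim (1+n≰n h)
  only _ (inj₁ loop-top**) = inj₂ refl
  only _ (inj₂ (succ _))   = inj₁ refl
  only _ (inj₂ loop-top**) = inj₂ refl

bottom-path** : ∀ {m} → Forced (Step path** (suc m)) 1 0 0
bottom-path** {m} = forced (inj₁ (succ (s≤s z≤n))) (inj₁ loop-bottom) only
  where
  only : ∀ d → Step path** (suc m) 0 d → d ≡ 1 ⊎ d ≡ 0
  only _ (inj₁ (succ _))    = inj₁ refl
  only _ (inj₁ loop-bottom) = inj₂ refl
  only _ (inj₂ loop-bottom) = inj₂ refl

-- Closed forced walks of length p through every arc of H

ascent : ∀ {kd K} a → a < K → Run (Step kd K) a 0 1 a (suc a)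
ascent zero    _ = []
ascent (suc a) h = ascent a (≤-trans (n≤1+n _) h) ∷ʳ forced-ascend h

-- The periods 2k-2, 2k-1, 2k for k = m+2, in the form produced by the walks.
double+2 : ∀ m → m + suc (suc (m + 0)) ≡ suc (suc (m + m))
double+2 = solve-∀

-- Up the graph, turn at the top, down again and turn at the bottom: a
-- closed forced walk through the arc 0 → 1 whose length is exactly p.
closed-base : ∀ kd m → Closed (Step kd (suc m)) (targetP (suc (suc m)) kd) 0 1
closed-base cyc m = ascent m ≤-refl ∷ʳ top-cyc ∷ʳ bottom-cyc
closed-base path m =
  subst (λ p → Closed (Step path (suc m)) p 0 1) (sym (double+2 m))
        (((ascent m ≤-refl ∷ʳ top-path) ++ reverse (ascent m ≤-refl)) ∷ʳ bottom-path)
closed-base path* m =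
  subst (λ p → Closed (Step path* (suc m)) p 0 1) (sym (cong suc (double+2 m)))
        (((ascent m ≤-refl ∷ʳ top-path* ∷ʳ forced-flip top-path*) ++ reverse (ascent m ≤-refl))
          ∷ʳ bottom-path*)
closed-base path** m =
  subst (λ p → Closed (Step path** (suc m)) p 0 1) (sym (cong (λ p → suc (suc p)) (double+2 m)))
        (((ascent m ≤-refl ∷ʳ top-path** ∷ʳ forced-flip top-path**) ++ reverse (ascent m ≤-refl))
          ∷ʳ bottom-path** ∷ʳ forced-flip bottom-path**)

closed-ascending : ∀ kd m a → a < suc m → Closed (Step kd (suc m)) (targetP (suc (suc m)) kd) a (suc a)
closed-ascending kd m a h = rotate-along (closed-base kd m) (ascent a h)

arc-closed : ∀ kd m {a b} → Step kd (suc m) a b → Closed (Step kd (suc m)) (targetP (suc (suc m)) kd) a b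
arc-closed kd m (inj₁ (succ h)) = closed-ascending kd m _ h
arc-closed kd m (inj₂ (succ h)) = reverse (closed-ascending kd m _ h)
arc-closed cyc m (inj₁ close) = rotate (closed-ascending cyc m m ≤-refl) top-cyc
arc-closed cyc m (inj₂ close) = reverse (rotate (closed-ascending cyc m m ≤-refl) top-cyc)
arc-closed path* m (inj₁ loop-top*) = rotate (closed-ascending path* m m ≤-refl) top-path*
arc-closed path* m (inj₂ loop-top*) = rotate (closed-ascending path* m m ≤-refl) top-path*
arc-closed path** m (inj₁ loop-top**) = rotate (closed-ascending path** m m ≤-refl) top-path**
arc-closed path** m (inj₂ loop-top**) = rotate (closed-ascending path** m m ≤-refl) top-path**
arc-closed path** m (inj₁ loop-bottom) = rotate (reverse (closed-ascending path** m 0 (s≤s z≤n))) bottom-path**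
arc-closed path** m (inj₂ loop-bottom) = rotate (reverse (closed-ascending path** m 0 (s≤s z≤n))) bottom-path**

-- Counting: a vertex of degree two has at most two neighbours

listSum-tabulate : ∀ {n} (f : Vector ℕ n) → listSum (tabulate f) ≡ ∑ f
listSum-tabulate {zero}  f = refl
listSum-tabulate {suc n} f = cong (f fzero +_) (listSum-tabulate (λ i → f (fsuc i)))

degree-sum : ∀ G u → degree G u ≡ ∑ (λ v → if E G u v then 1 else 0)
degree-sum G u = trans (cong listSum (map-tabulate (λ v → v) indicator)) (listSum-tabulate indicator)
  where
  indicator : Vector ℕ (n G)
  indicator v = if E G u v then 1 else 0

term≤∑ : ∀ {n} (f : Vector ℕ n) i → f i ≤ ∑ f
term≤∑ {suc n} f i = subst (f i ≤_) (sym (sum-remove {i = i} f)) (m≤m+n (f i) _)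

two-terms≤∑ : ∀ {n} (f : Vector ℕ n) {i j} → i ≢ j → f i + f j ≤ ∑ f
two-terms≤∑ {suc n} f {i} {j} i≢j = begin
  f i + f j                            ≡⟨ cong (f i +_) (sym (removeAt-punchOut f i≢j)) ⟩
  f i + removeAt f i (punchOut i≢j)    ≤⟨ +-monoʳ-≤ (f i) (term≤∑ (removeAt f i) _) ⟩
  f i + ∑ (removeAt f i)               ≡⟨ sym (sum-remove f) ⟩
  ∑ f                                  ∎
  where open ≤-Reasoning

three-terms≤∑ : ∀ {n} (f : Vector ℕ n) {i j l} → i ≢ j → i ≢ l → j ≢ l → f i + (f j + f l) ≤ ∑ f
three-terms≤∑ {suc n} f {i} {j} {l} i≢j i≢l j≢l = begin
  f i + (f j + f l)               ≡⟨ cong (f i +_) (sym (cong₂ _+_ (removeAt-punchOut f i≢j) (removeAt-punchOut f i≢l))) ⟩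
  f i + (f′ j′ + f′ l′)           ≤⟨ +-monoʳ-≤ (f i) (two-terms≤∑ f′ (λ e → j≢l (punchOut-injective i≢j i≢l e))) ⟩
  f i + ∑ f′                      ≡⟨ sym (sum-remove f) ⟩
  ∑ f                             ∎
  where
  open ≤-Reasoning
  f′ = removeAt f i
  j′ = punchOut i≢j
  l′ = punchOut i≢l

at-most-two-neighbours : ∀ G {u x z v} → degree G u ≡ 2 → Adj G u x → Adj G u z → x ≢ z
                       → Adj G u v → v ≡ x ⊎ v ≡ z
at-most-two-neighbours G {u} {x} {z} {v} deg ux uz x≢z uv with v ≟ x | v ≟ z
... | yes v≡x | _       = inj₁ v≡x
... | no _    | yes v≡z = inj₂ v≡z
... | no v≢x  | no v≢z  = ⊥-elim (<-irrefl refl three≤two)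
  where
  open ≤-Reasoning
  indicator : Vector ℕ (n G)
  indicator w = if E G u w then 1 else 0
  counts : ∀ {w} → Adj G u w → indicator w ≡ 1
  counts uw = cong (λ b → if b then 1 else 0) uw
  three≤two : 3 ≤ 2
  three≤two = begin
    3                                              ≡⟨ sym (cong₂ _+_ (counts ux) (cong₂ _+_ (counts uz) (counts uv))) ⟩
    indicator x + (indicator z + indicator v)      ≤⟨ three-terms≤∑ indicator x≢z (v≢x ∘′ sym) (v≢z ∘′ sym) ⟩
    ∑ indicator                                    ≡⟨ sym (degree-sum G u) ⟩
    degree G u                                     ≡⟨ deg ⟩
    2                                              ∎

adj-sym : ∀ G {u v} → Adj G u v → Adj G v u
adj-sym G {u} {v} uv = trans (Graph.sym G v u) uv

colour-edge : ∀ {G H r} → IsHRoleColouring G H r → ∀ {u v} → Adj G u v → Adj H (r u) (r v)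
colour-edge (_ , _ , edges) uv = from (edges _ _) (_ , _ , refl , refl , uv)

colour-lift : ∀ {G H r} → IsHRoleColouring G H r → ∀ {u h} → Adj H (r u) h
            → Σ (V G) λ v → Adj G u v × r v ≡ h
colour-lift (role , _ , edges) {u} adj with to (edges _ _) adj
... | u′ , v′ , ru′≡ru , rv′≡h , u′v′ = to (role u′ u ru′≡ru _) (v′ , u′v′ , rv′≡h)

degree-two-forced : ∀ {G H r} → IsHRoleColouring G H r → ∀ {u x z} → degree G u ≡ 2
                  → Adj G u x → Adj G u z → x ≢ z → Forced (Adj H) (r x) (r u) (r z)
degree-two-forced {G} {H} {r} col {u} {x} {z} deg ux uz x≢z =
  forced (colour-edge {G} {H} {r} col ux) (colour-edge {G} {H} {r} col uz) only
  where
  only : ∀ h → Adj H (r u) h → h ≡ r x ⊎ h ≡ r z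
  only h adj with colour-lift {G} {H} {r} col adj
  ... | v , uv , rv≡h = ⊎-map (λ v≡x → trans (sym rv≡h) (cong r v≡x))
                              (λ v≡z → trans (sym rv≡h) (cong r v≡z))
                              (at-most-two-neighbours G deg ux uz x≢z uv)

-- Paths, indexed by ℕ (indices beyond the end are reduced modulo p+1)

walk : ∀ {X : Set} P → (Fin (suc P) → X) → ℕ → X
walk P w j = w (j mod suc P)

toℕ-mod : ∀ {P j} → j ≤ P → toℕ (j mod suc P) ≡ j
toℕ-mod {P} {j} j≤P = trans (toℕ-fromℕ< _) (m<n⇒m%n≡m (s≤s j≤P))

walk-index : ∀ {X : Set} {P} (w : Fin (suc P) → X) (i : Fin (suc P)) {j} → toℕ i ≡ j → walk P w j ≡ w i
walk-index w i refl = cong w (toℕ-injective (toℕ-mod (toℕ≤pred[n] i)))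

module OnPath {G : Graph} {P : ℕ} {w : Fin (suc P) → V G} (isPath : IsPath G P w) where

  path-adj : ∀ {j} → suc j ≤ P → Adj G (walk P w j) (walk P w (suc j))
  path-adj h = subst₂ (Adj G) (sym (walk-index w (inject₁ i) (trans (toℕ-inject₁ i) (toℕ-fromℕ< h))))
                              (sym (walk-index w (fsuc i) (cong suc (toℕ-fromℕ< h))))
                              (proj₂ isPath i)
    where i = fromℕ< h

  walk-injective : ∀ {i j} → i ≤ P → j ≤ P → walk P w i ≡ walk P w j → i ≡ j
  walk-injective i≤P j≤P e =
    trans (sym (toℕ-mod i≤P)) (trans (cong toℕ (proj₁ isPath _ _ e)) (toℕ-mod j≤P))

  walk-forced : (∀ (i : Fin (suc P)) → 0 < toℕ i → toℕ i < P → degree G (w i) ≡ 2)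
              → ∀ {H r} → IsHRoleColouring G H r → ∀ j → 2 + j ≤ P
              → Forced (Adj H) (r (walk P w j)) (r (walk P w (1 + j))) (r (walk P w (2 + j)))
  walk-forced interior {H} {r} col j h =
    degree-two-forced {G} {H} {r} col inner-degree
      (adj-sym G (path-adj (≤-trans (n≤1+n _) h))) (path-adj h) ends-differ
    where
    i = suc j mod suc P
    i≡1+j = toℕ-mod (≤-trans (n≤1+n _) h)
    inner-degree = interior i (subst (0 <_) (sym i≡1+j) (s≤s z≤n)) (subst (_< P) (sym i≡1+j) h)
    ends-differ : walk P w j ≢ walk P w (2 + j)
    ends-differ e = <⇒≢ (m<n+m j (s≤s z≤n)) (walk-injective (≤-trans (m≤n+m j 2) h) h e)

  walk-start : walk P w 0 ≡ w fzero
  walk-start = walk-index w fzero refl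

  walk-end : walk P w P ≡ w (fromℕ P)
  walk-end = walk-index w (fromℕ P) (toℕ-fromℕ P)

-- The path has at least one edge, so its first arc exists.
period-positive : ∀ kd m → 1 ≤ targetP (suc (suc m)) kd
period-positive cyc    m = s≤s z≤n
period-positive path   m = subst (1 ≤_) (sym (double+2 m)) (s≤s z≤n)
period-positive path*  m = s≤s z≤n
period-positive path** m = s≤s z≤n

endpoints-agree : ∀ kd m (G : Graph) (w : Fin (suc (targetP (suc (suc m)) kd)) → V G)
  → IsPath G (targetP (suc (suc m)) kd) w
  → (∀ (i : Fin (suc (targetP (suc (suc m)) kd))) → 0 < toℕ i → toℕ i < targetP (suc (suc m)) kd → degree G (w i) ≡ 2)
  → (r : V G → V (model kd (suc m)))
  → IsHRoleColouring G (model kd (suc m)) r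
  → r (w fzero) ≡ r (w (fromℕ (targetP (suc (suc m)) kd)))
endpoints-agree kd m G w isPath interior r col = begin
  r (w fzero)       ≡⟨ cong r (sym walk-start) ⟩
  r (walk P w 0)    ≡⟨ toℕ-injective (sym returns-to-start) ⟩
  r (walk P w P)    ≡⟨ cong r walk-end ⟩
  r (w (fromℕ P))   ∎
  where
  open ≡-Reasoning
  P = targetP (suc (suc m)) kd
  open OnPath {G} {P} {w} isPath
  c : ℕ → ℕ
  c j = toℕ (r (walk P w j))
  forced-colours : ∀ j → 2 + j ≤ P → Forced (Step kd (suc m)) (c j) (c (1 + j)) (c (2 + j))
  forced-colours j h = forced-map toℕ (λ {a} {b} → model-decode a b) (λ {a} → model-encode a)
                                  (walk-forced interior {model kd (suc m)} {r} col j h)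
  first-arc : Step kd (suc m) (c 0) (c 1)
  first-arc = model-decode _ _ (colour-edge {G} {model kd (suc m)} {r} col (path-adj (period-positive kd m)))
  returns-to-start : c P ≡ c 0
  returns-to-start = returns c (arc-closed kd m first-arc) forced-colours

-- Each target graph is by definition the model graph of its kind.
lemma1 : (k : ℕ) → 2 ≤ k → (kd : Kind) → (G : Graph)
       → (w : Fin (suc (targetP k kd)) → V G)
       → IsPath G (targetP k kd) w
       → (∀ (i : Fin (suc (targetP k kd))) → 0 < toℕ i → toℕ i < targetP k kd → degree G (w i) ≡ 2)
       → (r : V G → V (targetH k kd))
       → IsHRoleColouring G (targetH k kd) r
       → r (w fzero) ≡ r (w (fromℕ (targetP k kd)))
lemma1 (suc (suc m)) (s≤s (s≤s z≤n)) cyc    = endpoints-agree cyc m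
lemma1 (suc (suc m)) (s≤s (s≤s z≤n)) path   = endpoints-agree path m
lemma1 (suc (suc m)) (s≤s (s≤s z≤n)) path*  = endpoints-agree path* m
lemma1 (suc (suc m)) (s≤s (s≤s z≤n)) path** = endpoints-agree path** m
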